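{- Let $G$ be an undirected graph with a 2-edge-colouring $c:E(G)\to\{1,2\}$, and let $C$ be a properly coloured closed walk of odd length in $G$. Then $C$ uses each stubborn edge of $G$ exactly once.
   Context: A walk is a sequence of vertices with consecutive vertices adjacent (vertices and edges may repeat); its length is its number of edges; it is closed if it starts and ends at the same vertex. A walk is properly coloured if no two consecutive edges of it have the same colour (for a closed walk this concerns consecutive edges along the sequence from start to end). An edge is stubborn if it belongs to every closed walk of odd length in $G$. -}

module Defs where

open import Data.Nat using (ℕ; suc; _+_; _*_)
open import Data.Fin using (Fin; zero; suc; inject₁; fromℕ; toℕ)
open import Data.Product using (Σ; ∃; _×_; _,_)
open import Data.Sum using (_⊎_)
open import Relation.Binary.PropositionalEquality using (_≡_; _≢_)
open import Relation.Nullary using (¬_)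

record Graph : Set₁ where
  field
    n      : ℕ
    Adj    : Fin n → Fin n → Set
    sym    : ∀ {u v} → Adj u v → Adj v u
    irrefl : ∀ {v} → ¬ Adj v v

module _ (G : Graph) where
  open Graph G

  -- A 2-edge-colouring: a colour in Fin 2 for every unordered pair
  -- (a symmetric function); only its values on edges matter.
  record TwoColouring : Set where
    field
      col     : Fin n → Fin n → Fin 2
      col-sym : ∀ u v → col u v ≡ col v u

  -- A walk of length ℓ (ℓ edges): vertex sequence w 0, …, w ℓ,
  -- consecutive vertices adjacent.
  IsWalk : (ℓ : ℕ) → (Fin (suc ℓ) → Fin n) → Set
  IsWalk ℓ w = ∀ (i : Fin ℓ) → Adj (w (inject₁ i)) (w (suc i))

  IsClosedWalk : (ℓ : ℕ) → (Fin (suc ℓ) → Fin n) → Set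
  IsClosedWalk ℓ w = IsWalk ℓ w × (w zero ≡ w (fromℕ ℓ))

  EdgeAt : (ℓ : ℕ) → (Fin (suc ℓ) → Fin n) → Fin ℓ → Fin n → Fin n → Set
  EdgeAt ℓ w i x y =
    (w (inject₁ i) ≡ x × w (suc i) ≡ y) ⊎ (w (inject₁ i) ≡ y × w (suc i) ≡ x)

  UsesEdge : (ℓ : ℕ) → (Fin (suc ℓ) → Fin n) → Fin n → Fin n → Set
  UsesEdge ℓ w x y = ∃ λ (i : Fin ℓ) → EdgeAt ℓ w i x y

  UsesEdgeExactlyOnce : (ℓ : ℕ) → (Fin (suc ℓ) → Fin n) → Fin n → Fin n → Set
  UsesEdgeExactlyOnce ℓ w x y =
    UsesEdge ℓ w x y × (∀ i j → EdgeAt ℓ w i x y → EdgeAt ℓ w j x y → i ≡ j)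

  Odd : ℕ → Set
  Odd ℓ = ∃ λ k → ℓ ≡ suc (2 * k)

  -- Properly coloured: consecutive edges i, i+1 along the sequence
  -- (not cyclically wrapping around) have different colours.
  IsProperlyColoured : TwoColouring → (ℓ : ℕ) → (Fin (suc ℓ) → Fin n) → Set
  IsProperlyColoured c ℓ w =
    ∀ (i j : Fin ℓ) → toℕ j ≡ suc (toℕ i) →
      col (w (inject₁ i)) (w (suc i)) ≢ col (w (inject₁ j)) (w (suc j))
    where open TwoColouring c

  Stubborn : Fin n → Fin n → Set
  Stubborn x y =
    Adj x y ×
    (∀ (ℓ : ℕ) (w : Fin (suc ℓ) → Fin n) →
       IsClosedWalk ℓ w → Odd ℓ → UsesEdge ℓ w x y)

-- Let e = xy be stubborn, so every closed walk avoiding e has even length, and suppose the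
-- properly coloured odd closed walk C traverses e twice.  Between two consecutive traversals
-- C follows a walk P avoiding e; its first and last edges both differ in colour from e, so
-- in a 2-colouring they agree, and alternation of colours along P makes P odd.  P joins
-- endpoints of e, so either P is itself an odd closed walk avoiding e, or it is an odd
-- walk from y to x avoiding e.  In the second case, replacing every traversal of e in C by
-- P (or its reverse) replaces a single edge by an odd number of edges each time, and so
-- yields an odd closed walk avoiding e.  Either way the stubbornness of e is contradicted.
module Submission where

open import Defs
open import Data.Nat using (ℕ; zero; suc; _+_; _*_; _≤_; _<_; s≤s; z<s; s≤s⁻¹; parity)
open import Data.Nat.Properties
  using (+-suc; m<n⇒m<1+n; m<1+n⇒m<n∨m≡n; n<1+n; <⇒≤; <-trans; ≤-<-trans; +-monoˡ-<; +-monoˡ-≤;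
         m∸n+n≡m; <-cmp)
open import Data.Fin using (Fin; zero; suc; inject₁; fromℕ; fromℕ<; toℕ; _≟_)
open import Data.Fin.Properties using (toℕ-fromℕ<; toℕ-injective; toℕ<n)
open import Data.Parity.Base using (0ℙ; 1ℙ; _⁻¹) renaming (_+_ to _+ℙ_)
open import Data.Parity.Properties using (+-homo-+; *-homo-*)
open import Data.Product using (∃-syntax; _×_; _,_; proj₁; proj₂; uncurry)
open import Data.Sum using (_⊎_; inj₁; inj₂; [_,_])
open import Data.Empty using (⊥; ⊥-elim)
open import Function using (_∘_)
open import Relation.Binary using (tri<; tri≈; tri>)
open import Relation.Binary.PropositionalEquality
  using (_≡_; _≢_; refl; sym; trans; cong; cong₂; subst; subst₂; module ≡-Reasoning)
open import Relation.Nullary using (¬_; Dec; yes; no)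
open import Relation.Nullary.Decidable using (_×-dec_; _⊎-dec_)
open import Relation.Unary using (Decidable)

parity-suc : ∀ n → parity (suc n) ≡ parity n ⁻¹
parity-suc = +-homo-+ 1

module _ (G : Graph) where

  Odd⇒parity≡1ℙ : ∀ {m} → Odd G m → parity m ≡ 1ℙ
  Odd⇒parity≡1ℙ (k , refl) = trans (parity-suc (2 * k)) (cong _⁻¹ (*-homo-* 2 k))

  parity≡1ℙ⇒Odd : ∀ m → parity m ≡ 1ℙ → Odd G m
  parity≡1ℙ⇒Odd (suc zero)    _   = 0 , refl
  parity≡1ℙ⇒Odd (suc (suc m)) odd with parity≡1ℙ⇒Odd m odd
  ... | k , refl = suc k , cong (2 +_) (sym (+-suc k (k + 0)))

fin2-≢-≢⇒≡ : {p q r : Fin 2} → p ≢ q → r ≢ q → p ≡ r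
fin2-≢-≢⇒≡ {zero}     {_}        {zero}     _   _   = refl
fin2-≢-≢⇒≡ {suc zero} {_}        {suc zero} _   _   = refl
fin2-≢-≢⇒≡ {zero}     {zero}     {suc zero} p≢q _   = ⊥-elim (p≢q refl)
fin2-≢-≢⇒≡ {zero}     {suc zero} {suc zero} _   r≢q = ⊥-elim (r≢q refl)
fin2-≢-≢⇒≡ {suc zero} {zero}     {zero}     _   r≢q = ⊥-elim (r≢q refl)
fin2-≢-≢⇒≡ {suc zero} {suc zero} {zero}     p≢q _   = ⊥-elim (p≢q refl)

alternating-parity : (κ : ℕ → Fin 2) (d : ℕ) → (∀ i → i < d → κ i ≢ κ (suc i)) →
                     (κ d ≡ κ 0 → parity d ≡ 0ℙ) × (κ d ≢ κ 0 → parity d ≡ 1ℙ)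
alternating-parity κ zero    _           = (λ _ → refl) , (λ κ0≢κ0 → ⊥-elim (κ0≢κ0 refl))
alternating-parity κ (suc d) alternating = same , different
  where
    previous = alternating-parity κ d (λ i → alternating i ∘ m<n⇒m<1+n)
    last≢ : κ d ≢ κ (suc d)
    last≢ = alternating d (n<1+n d)
    same : κ (suc d) ≡ κ 0 → parity (suc d) ≡ 0ℙ
    same eq = trans (parity-suc d) (cong _⁻¹ (proj₂ previous (λ eq′ → last≢ (trans eq′ (sym eq)))))
    different : κ (suc d) ≢ κ 0 → parity (suc d) ≡ 1ℙ
    different ne = trans (parity-suc d) (cong _⁻¹ (proj₁ previous (fin2-≢-≢⇒≡ last≢ (ne ∘ sym))))

module _ {p} {P : ℕ → Set p} (P? : Decidable P) where

  private
    least-below : ∀ n → (∀ k → k < n → ¬ P k) ⊎ ∃[ m ] m < n × P m × (∀ k → k < m → ¬ P k)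
    least-below zero = inj₁ (λ _ ())
    least-below (suc n) with least-below n
    ... | inj₂ (m , m<n , pm , below) = inj₂ (m , m<n⇒m<1+n m<n , pm , below)
    ... | inj₁ none with P? n
    ...   | yes pn = inj₂ (n , n<1+n n , pn , none)
    ...   | no ¬pn = inj₁ (λ k → [ none k , (λ { refl → ¬pn }) ] ∘ m<1+n⇒m<n∨m≡n)

  least : ∀ {n} → P n → ∃[ m ] m ≤ n × P m × (∀ k → k < m → ¬ P k)
  least {n} pn with least-below (suc n)
  ... | inj₁ none                   = ⊥-elim (none n (n<1+n n) pn)
  ... | inj₂ (m , m<1+n , pm , below) = m , s≤s⁻¹ m<1+n , pm , below

clamp : ∀ ℓ → ℕ → Fin (suc ℓ)
clamp _       zero    = zero
clamp zero    (suc k) = zero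
clamp (suc ℓ) (suc k) = suc (clamp ℓ k)

clamp-toℕ : ∀ {ℓ} (i : Fin ℓ) → clamp ℓ (toℕ i) ≡ inject₁ i
clamp-toℕ zero    = refl
clamp-toℕ (suc i) = cong suc (clamp-toℕ i)

clamp-suc-toℕ : ∀ {ℓ} (i : Fin ℓ) → clamp ℓ (suc (toℕ i)) ≡ suc i
clamp-suc-toℕ zero    = refl
clamp-suc-toℕ (suc i) = cong suc (clamp-suc-toℕ i)

clamp-self : ∀ ℓ → clamp ℓ ℓ ≡ fromℕ ℓ
clamp-self zero    = refl
clamp-self (suc ℓ) = cong suc (clamp-self ℓ)

module AvoidingEdge (G : Graph) (x y : Fin (Graph.n G)) where
  open Graph G renaming (sym to adj-sym)

  Traverses : Fin n → Fin n → Set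
  Traverses u v = (u ≡ x × v ≡ y) ⊎ (u ≡ y × v ≡ x)

  traverses-sym : ∀ {u v} → Traverses u v → Traverses v u
  traverses-sym (inj₁ (u≡x , v≡y)) = inj₂ (v≡y , u≡x)
  traverses-sym (inj₂ (u≡y , v≡x)) = inj₁ (v≡x , u≡y)

  traverses? : ∀ u v → Dec (Traverses u v)
  traverses? u v = ((u ≟ x) ×-dec (v ≟ y)) ⊎-dec ((u ≟ y) ×-dec (v ≟ x))

  Endpoint : Fin n → Set
  Endpoint u = u ≡ x ⊎ u ≡ y

  source : ∀ {u v} → Traverses u v → Endpoint u
  source (inj₁ (u≡x , _)) = inj₁ u≡x
  source (inj₂ (u≡y , _)) = inj₂ u≡y

  target : ∀ {u v} → Traverses u v → Endpoint v
  target (inj₁ (_ , v≡y)) = inj₂ v≡y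
  target (inj₂ (_ , v≡x)) = inj₁ v≡x

  data Avoiding : Fin n → Fin n → ℕ → Set where
    []   : ∀ {u} → Avoiding u u 0
    step : ∀ {u v t m} → Adj u v → ¬ Traverses u v → Avoiding v t m → Avoiding u t (suc m)

  infixr 5 _++_
  _++_ : ∀ {u v t a b} → Avoiding u v a → Avoiding v t b → Avoiding u t (a + b)
  []               ++ q = q
  step adj ¬tr p ++ q = step adj ¬tr (p ++ q)

  snoc : ∀ {u v t m} → Avoiding u v m → Adj v t → ¬ Traverses v t → Avoiding u t (suc m)
  snoc []                adj ¬tr = step adj ¬tr []
  snoc (step adj′ ¬tr′ p) adj ¬tr = step adj′ ¬tr′ (snoc p adj ¬tr)

  reverse : ∀ {u v m} → Avoiding u v m → Avoiding v u m
  reverse []              = []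
  reverse (step adj ¬tr p) = snoc (reverse p) (adj-sym adj) (¬tr ∘ traverses-sym)

  vertices : ∀ {u v m} → Avoiding u v m → Fin (suc m) → Fin n
  vertices {u} _            zero    = u
  vertices     (step _ _ p) (suc i) = vertices p i

  vertices-last : ∀ {u v m} (p : Avoiding u v m) → vertices p (fromℕ m) ≡ v
  vertices-last []           = refl
  vertices-last (step _ _ p) = vertices-last p

  vertices-isWalk : ∀ {u v m} (p : Avoiding u v m) → IsWalk G m (vertices p)
  vertices-isWalk (step adj _ _) zero    = adj
  vertices-isWalk (step _ _ p)   (suc i) = vertices-isWalk p i

  vertices-avoid : ∀ {u v m} (p : Avoiding u v m) (i : Fin m) → ¬ EdgeAt G m (vertices p) i x y
  vertices-avoid (step _ ¬tr _) zero    = ¬tr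
  vertices-avoid (step _ _ p)   (suc i) = vertices-avoid p i

  segment : (f : ℕ → Fin n) (d : ℕ) →
            (∀ k → k < d → Adj (f k) (f (suc k)) × ¬ Traverses (f k) (f (suc k))) →
            Avoiding (f 0) (f d) d
  segment f zero    _     = []
  segment f (suc d) steps = uncurry step (steps 0 z<s) (segment (f ∘ suc) d (λ k → steps (suc k) ∘ s≤s))

  OddDetour : Set
  OddDetour = ∃[ m ] Avoiding y x m × parity m ≡ 1ℙ

  detour : ∀ {u v} → OddDetour → Traverses u v → ∃[ m ] Avoiding u v m × parity m ≡ 1ℙ
  detour (m , p , odd) (inj₁ (refl , refl)) = m , reverse p , odd
  detour (m , p , odd) (inj₂ (refl , refl)) = m , p , odd

  reroute : OddDetour → (f : ℕ → Fin n) (d : ℕ) → (∀ k → k < d → Adj (f k) (f (suc k))) →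
            ∃[ m ] Avoiding (f 0) (f d) m × parity m ≡ parity d
  reroute D f zero    _   = 0 , [] , refl
  reroute D f (suc d) adj with reroute D (f ∘ suc) d (λ k → adj (suc k) ∘ s≤s) | traverses? (f 0) (f 1)
  ... | m , p , m≈d | no ¬tr = suc m , step (adj 0 z<s) ¬tr p , (begin
    parity (suc m)  ≡⟨ parity-suc m ⟩
    parity m ⁻¹     ≡⟨ cong _⁻¹ m≈d ⟩
    parity d ⁻¹     ≡⟨ sym (parity-suc d) ⟩
    parity (suc d)  ∎)
    where open ≡-Reasoning
  ... | m , p , m≈d | yes tr with detour D tr
  ...   | m′ , q , odd = m′ + m , q ++ p , (begin
    parity (m′ + m)          ≡⟨ +-homo-+ m′ m ⟩
    parity m′ +ℙ parity m    ≡⟨ cong₂ _+ℙ_ odd m≈d ⟩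
    parity d ⁻¹              ≡⟨ sym (parity-suc d) ⟩
    parity (suc d)           ∎)
    where open ≡-Reasoning

  module _ (stubborn : Stubborn G x y) where

    closed-avoiding-even : ∀ {u m} → Avoiding u u m → parity m ≢ 1ℙ
    closed-avoiding-even {m = m} p odd
      with proj₂ stubborn m (vertices p) (vertices-isWalk p , sym (vertices-last p)) (parity≡1ℙ⇒Odd G m odd)
    ... | i , traversal = vertices-avoid p i traversal

    odd-detour : ∀ {u v m} → Endpoint u → Endpoint v → Avoiding u v m → parity m ≡ 1ℙ → OddDetour
    odd-detour (inj₁ refl) (inj₁ refl) p odd = ⊥-elim (closed-avoiding-even p odd)
    odd-detour (inj₂ refl) (inj₂ refl) p odd = ⊥-elim (closed-avoiding-even p odd)
    odd-detour (inj₁ refl) (inj₂ refl) p odd = _ , reverse p , odd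
    odd-detour (inj₂ refl) (inj₁ refl) p odd = _ , p , odd

module ProperOddClosedWalk (G : Graph) (c : TwoColouring G) (x y : Fin (Graph.n G))
         (stubborn : Stubborn G x y) (ℓ : ℕ) (w : Fin (suc ℓ) → Fin (Graph.n G))
         (closed : IsClosedWalk G ℓ w) (odd : Odd G ℓ) (proper : IsProperlyColoured G c ℓ w) where
  open Graph G using (n; Adj)
  open TwoColouring c
  open AvoidingEdge G x y

  vertex : ℕ → Fin n
  vertex k = w (clamp ℓ k)

  vertex-toℕ : ∀ i → vertex (toℕ i) ≡ w (inject₁ i)
  vertex-toℕ i = cong w (clamp-toℕ i)

  vertex-suc-toℕ : ∀ i → vertex (suc (toℕ i)) ≡ w (suc i)
  vertex-suc-toℕ i = cong w (clamp-suc-toℕ i)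

  Uses : ℕ → Set
  Uses k = Traverses (vertex k) (vertex (suc k))

  colour : ℕ → Fin 2
  colour k = col (vertex k) (vertex (suc k))

  colour-toℕ : ∀ i → colour (toℕ i) ≡ col (w (inject₁ i)) (w (suc i))
  colour-toℕ i = cong₂ col (vertex-toℕ i) (vertex-suc-toℕ i)

  edgeAt⇒Uses : ∀ i → EdgeAt G ℓ w i x y → Uses (toℕ i)
  edgeAt⇒Uses i = subst₂ Traverses (sym (vertex-toℕ i)) (sym (vertex-suc-toℕ i))

  adjacent : ∀ k → k < ℓ → Adj (vertex k) (vertex (suc k))
  adjacent k k<ℓ with fromℕ< k<ℓ | toℕ-fromℕ< k<ℓ
  ... | i | refl = subst₂ Adj (sym (vertex-toℕ i)) (sym (vertex-suc-toℕ i)) (proj₁ closed i)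

  colour-alternates : ∀ k → suc k < ℓ → colour k ≢ colour (suc k)
  colour-alternates k 1+k<ℓ with fromℕ< (<⇒≤ 1+k<ℓ) | toℕ-fromℕ< (<⇒≤ 1+k<ℓ)
  ... | i | refl = λ same → proper i j j≡1+i (begin
    col (w (inject₁ i)) (w (suc i))  ≡⟨ sym (colour-toℕ i) ⟩
    colour (toℕ i)                   ≡⟨ same ⟩
    colour (suc (toℕ i))             ≡⟨ cong colour (sym j≡1+i) ⟩
    colour (toℕ j)                   ≡⟨ colour-toℕ j ⟩
    col (w (inject₁ j)) (w (suc j))  ∎)
    where
      open ≡-Reasoning
      j = fromℕ< 1+k<ℓ
      j≡1+i = toℕ-fromℕ< 1+k<ℓ

  colour-Uses : ∀ {k} → Uses k → colour k ≡ col x y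
  colour-Uses (inj₁ (refl , refl)) = refl
  colour-Uses (inj₂ (refl , refl)) = col-sym y x

  no-odd-detour : ¬ OddDetour
  no-odd-detour D with reroute D vertex ℓ adjacent
  ... | m , p , m≈ℓ = closed-avoiding-even stubborn (subst (λ t → Avoiding (w zero) t m) returns p)
                                            (trans m≈ℓ (Odd⇒parity≡1ℙ G odd))
    where
      returns : vertex ℓ ≡ w zero
      returns = trans (cong w (clamp-self ℓ)) (sym (proj₂ closed))

  -- Offsets are added on the left, so that 0 + s and suc k + s compute.
  no-consecutive-Uses : ∀ a d → d + suc a < ℓ → Uses a → Uses (d + suc a) →
                        (∀ k → k < d → ¬ Uses (k + suc a)) → ⊥
  no-consecutive-Uses a zero    bound first next _ =
    colour-alternates a bound (trans (colour-Uses first) (sym (colour-Uses next)))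
  no-consecutive-Uses a (suc d) bound first next between =
    no-odd-detour (odd-detour stubborn (target first) (source next) between-walk between-odd)
    where
      s = suc a
      inside : ∀ {k} → k < suc d → k + s < ℓ
      inside k<1+d = <-trans (+-monoˡ-< s k<1+d) bound
      between-walk : Avoiding (vertex s) (vertex (suc d + s)) (suc d)
      between-walk = segment (vertex ∘ (_+ s)) (suc d) (λ k k<1+d → adjacent (k + s) (inside k<1+d) , between k k<1+d)
      κ : ℕ → Fin 2
      κ k = colour (k + s)
      κ0≢e : κ 0 ≢ col x y
      κ0≢e eq = colour-alternates a (inside z<s) (trans (colour-Uses first) (sym eq))
      κd≢e : κ d ≢ col x y
      κd≢e eq = colour-alternates (d + s) bound (trans eq (sym (colour-Uses next)))
      between-odd : parity (suc d) ≡ 1ℙ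
      between-odd = trans (parity-suc d) (cong _⁻¹
        (proj₁ (alternating-parity κ d (λ i i<d → colour-alternates (i + s) (inside (s≤s i<d))))
               (fin2-≢-≢⇒≡ κd≢e κ0≢e)))

  no-two-Uses : ∀ {a b} → a < b → b < ℓ → Uses a → Uses b → ⊥
  no-two-Uses {a} {b} a<b b<ℓ first later
    with least (λ k → traverses? (vertex (k + suc a)) (vertex (suc (k + suc a))))
               (subst Uses (sym (m∸n+n≡m a<b)) later)
  ... | d , d≤ , next , between =
    no-consecutive-Uses a d bound first next between
    where
      bound : d + suc a < ℓ
      bound = ≤-<-trans (subst (d + suc a ≤_) (m∸n+n≡m a<b) (+-monoˡ-≤ (suc a) d≤)) b<ℓ

proposition3 : (G : Graph) (c : TwoColouring G)
    (ℓ : ℕ) (w : Fin (suc ℓ) → Fin (Graph.n G)) →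
    IsClosedWalk G ℓ w → Odd G ℓ → IsProperlyColoured G c ℓ w →
    ∀ (x y : Fin (Graph.n G)) → Stubborn G x y → UsesEdgeExactlyOnce G ℓ w x y
proposition3 G c ℓ w closed odd proper x y stubborn = proj₂ stubborn ℓ w closed odd , at-most-once
  where
    open ProperOddClosedWalk G c x y stubborn ℓ w closed odd proper
    at-most-once : ∀ i j → EdgeAt G ℓ w i x y → EdgeAt G ℓ w j x y → i ≡ j
    at-most-once i j at-i at-j with <-cmp (toℕ i) (toℕ j)
    ... | tri< i<j _ _ = ⊥-elim (no-two-Uses i<j (toℕ<n j) (edgeAt⇒Uses i at-i) (edgeAt⇒Uses j at-j))
    ... | tri≈ _ i≡j _ = toℕ-injective i≡j
    ... | tri> _ _ j<i = ⊥-elim (no-two-Uses j<i (toℕ<n i) (edgeAt⇒Uses j at-j) (edgeAt⇒Uses i at-i))
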